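{- Let $P$ be a $(d+1)\times(d+1)$ transition matrix defining an ergodic Markov chain on the path $\{0,1,\dots,d\}$ (i.e. $P_{i,j}=0$ whenever $|i-j|>1$). If $P_{i,i}\ge1/2$ for all $0\le i\le d$, then for every $0\le i\le d$ the sequence $t\mapsto (P^t)_{i,i}$ is non-increasing in $t\in\mathbb{N}$.
   Context: No further definitions needed. -}

module Defs where

open import Level using (Level; suc; _⊔_)
open import Data.Nat as ℕ using (ℕ; zero) renaming (suc to 1+)
open import Data.Nat.Divisibility using (_∣_)
open import Data.Fin using (Fin; toℕ; _≟_) renaming (zero to fzero; suc to fsuc)
open import Data.Product using (Σ; ∃; _×_)
open import Relation.Nullary using (¬_; yes; no)
open import Relation.Binary.PropositionalEquality using (_≡_; _≢_)
open import Relation.Binary.Structures using (IsTotalOrder)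
open import Algebra.Structures using (IsCommutativeRing)

-- An ordered field (axiomatised; ℝ is the intended model).
-- Equality is propositional equality on the carrier.
record OrderedField (c ℓ : Level) : Set (suc (c ⊔ ℓ)) where
  infixl 6 _+_
  infixl 7 _*_
  infix  4 _≤_ _<_
  field
    Carrier  : Set c
    _+_ _*_  : Carrier → Carrier → Carrier
    -_       : Carrier → Carrier
    0# 1#    : Carrier
    _≤_      : Carrier → Carrier → Set ℓ
    isCommutativeRing : IsCommutativeRing _≡_ _+_ _*_ -_ 0# 1#
    isTotalOrder      : IsTotalOrder _≡_ _≤_
    0≢1      : 0# ≢ 1#
    inverse  : ∀ x → x ≢ 0# → Σ Carrier (λ y → x * y ≡ 1#)
    +-mono-≤ : ∀ {x y} z → x ≤ y → x + z ≤ y + z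
    *-nonneg : ∀ {x y} → 0# ≤ x → 0# ≤ y → 0# ≤ x * y

  _<_ : Carrier → Carrier → Set (c ⊔ ℓ)
  x < y = x ≤ y × x ≢ y

module Matrices {c ℓ} (F : OrderedField c ℓ) where
  open OrderedField F

  Matrix : ℕ → Set c
  Matrix n = Fin n → Fin n → Carrier

  sumFin : ∀ {n} → (Fin n → Carrier) → Carrier
  sumFin {zero}  f = 0#
  sumFin {1+ n}  f = f fzero + sumFin (λ k → f (fsuc k))

  identity : ∀ {n} → Matrix n
  identity i j with i ≟ j
  ... | yes _ = 1#
  ... | no  _ = 0#

  _⊗_ : ∀ {n} → Matrix n → Matrix n → Matrix n
  (A ⊗ B) i j = sumFin (λ k → A i k * B k j)

  _^_ : ∀ {n} → Matrix n → ℕ → Matrix n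
  P ^ zero   = identity
  P ^ (1+ t) = (P ^ t) ⊗ P

  IsStochastic : ∀ {n} → Matrix n → Set (c ⊔ ℓ)
  IsStochastic {n} P = (∀ i j → 0# ≤ P i j) × (∀ i → sumFin (λ j → P i j) ≡ 1#)

  Irreducible : ∀ {n} → Matrix n → Set (c ⊔ ℓ)
  Irreducible {n} P = ∀ (i j : Fin n) → ∃ λ t → 0# < (P ^ t) i j

  -- aperiodic: every state has period gcd{ t ≥ 1 : (P^t)_{ii} > 0 } = 1,
  -- i.e. every common divisor k of all return times equals 1
  Aperiodic : ∀ {n} → Matrix n → Set (c ⊔ ℓ)
  Aperiodic {n} P = ∀ (i : Fin n) (k : ℕ) →
    (∀ t → 1 ℕ.≤ t → 0# < (P ^ t) i i → k ∣ t) → k ≡ 1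

  IsErgodic : ∀ {n} → Matrix n → Set (c ⊔ ℓ)
  IsErgodic P = IsStochastic P × Irreducible P × Aperiodic P

  IsPathChain : ∀ {n} → Matrix n → Set c
  IsPathChain {n} P = ∀ (i j : Fin n) → 1 ℕ.< ℕ.∣ toℕ i - toℕ j ∣ → P i j ≡ 0#

module Submission where

-- A chain P on the path {0,…,d} is reversible: with forward and
-- backward edge probabilities A_j = P(j,j+1), B_j = P(j+1,j) and weights
-- w_x = ∏_{j<x} A_j ∏_{j≥x} B_j one has w_x P_xy = w_y P_yx, and
-- irreducibility makes every A_j, B_j (hence every w_x) non-zero.  For a
-- reversible P, w_i (P^(a+b))_ii = ⟨h_a, h_b⟩_w where h_s is column i of P^s
-- and h_(s+1) = P h_s.  So the claim reduces to two inequalities for the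
-- weighted inner product:  ⟨h, P h⟩ ≤ ⟨h, h⟩ (odd → even: 2ab ≤ a² + b²
-- averaged over transitions) and ⟨P h, P h⟩ ≤ ⟨h, P h⟩ (even → odd: for a
-- lazy chain R = 2P - I is again reversible stochastic, and contracts ⟨·,·⟩_w
-- by Jensen's inequality).

open import Defs
open import Data.Nat as ℕ using (ℕ; suc; zero; s≤s; z≤n)
import Data.Nat.Properties as ℕₚ
open import Data.Fin as Fin using (Fin; toℕ; inject₁) renaming (zero to fzero; suc to fsuc)
open import Data.Fin.Properties using (toℕ-inject₁; toℕ-injective)
open import Data.Product using (Σ; _×_; _,_; proj₁; proj₂)
open import Data.Sum using (_⊎_; inj₁; inj₂)
open import Data.Empty using (⊥; ⊥-elim)
open import Relation.Nullary using (¬_; Dec; yes; no)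
open import Relation.Unary using (Decidable)
open import Relation.Binary.PropositionalEquality
open import Algebra.Bundles using (CommutativeRing)
open import Algebra.Structures using (IsCommutativeRing)
open import Relation.Binary.Structures using (IsTotalOrder)
import Algebra.Properties.Ring as RingProperties
import Algebra.Properties.Semiring.Sum as SemiringSum

data Position {d : ℕ} : Fin (suc d) → Fin (suc d) → Set where
  same : ∀ x → Position x x
  up   : ∀ (j : Fin d) → Position (inject₁ j) (fsuc j)
  down : ∀ (j : Fin d) → Position (fsuc j) (inject₁ j)
  far  : ∀ {x y} → 1 ℕ.< ℕ.∣ toℕ x - toℕ y ∣ → Position x y

position : ∀ {d} (x y : Fin (suc d)) → Position x y
position fzero fzero = same fzero
position {suc d} fzero (fsuc fzero) = up fzero
position {suc d} fzero (fsuc (fsuc y)) = far (s≤s (s≤s z≤n))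
position {suc d} (fsuc fzero) fzero = down fzero
position {suc d} (fsuc (fsuc x)) fzero = far (s≤s (s≤s z≤n))
position {suc d} (fsuc x) (fsuc y) with position x y
... | same x = same (fsuc x)
... | up j   = up (fsuc j)
... | down j = down (fsuc j)
... | far p  = far p

crossing : ∀ {d} (j : Fin d) (m y : Fin (suc d)) → toℕ m ℕ.≤ toℕ j → toℕ j ℕ.< toℕ y →
  1 ℕ.< ℕ.∣ toℕ m - toℕ y ∣ ⊎ (m ≡ inject₁ j × y ≡ fsuc j)
crossing j m y m≤j j<y with position m y
... | same x  = ⊥-elim (ℕₚ.<-irrefl refl (ℕₚ.≤-<-trans m≤j j<y))
... | far p   = inj₁ p
... | up i    = inj₂ (cong inject₁ i≡j , cong fsuc i≡j)
  where
  i≡j : i ≡ j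
  i≡j = toℕ-injective (ℕₚ.≤-antisym (subst (ℕ._≤ toℕ j) (toℕ-inject₁ i) m≤j) (ℕₚ.≤-pred j<y))
... | down i  = ⊥-elim (ℕₚ.<⇒≱ j<i (ℕₚ.≤-trans (ℕₚ.n≤1+n (toℕ i)) m≤j))
  where
  j<i : toℕ j ℕ.< toℕ i
  j<i = subst (toℕ j ℕ.<_) (toℕ-inject₁ i) j<y

data EvenOdd : ℕ → Set where
  even : ∀ s → EvenOdd (s ℕ.+ s)
  odd  : ∀ s → EvenOdd (suc (s ℕ.+ s))

evenOdd : ∀ t → EvenOdd t
evenOdd zero = even zero
evenOdd (suc t) with evenOdd t
... | even s = odd s
... | odd s = subst EvenOdd (cong suc (ℕₚ.+-suc s s)) (even (suc s))

module LazyChains {c ℓ} (F : OrderedField c ℓ) where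
  open OrderedField F
  open Matrices F
  open IsCommutativeRing isCommutativeRing
    using (+-identityˡ; +-identityʳ; -‿inverseˡ; -‿inverseʳ; zeroˡ; zeroʳ; distribˡ; distribʳ;
           *-identityˡ; *-identityʳ; +-comm; +-assoc; *-comm; *-assoc)
  open IsTotalOrder isTotalOrder using (antisym; total)
    renaming (refl to ≤-refl; trans to ≤-trans; reflexive to ≤-reflexive)

  commutativeRing : CommutativeRing c c
  commutativeRing = record { isCommutativeRing = isCommutativeRing }

  open RingProperties (CommutativeRing.ring commutativeRing) using (-‿distribˡ-*; -‿distribʳ-*; -‿involutive; +-cancelʳ)
  open import Algebra.Solver.Ring.NaturalCoefficients.Default (CommutativeRing.commutativeSemiring commutativeRing)
    using (solve; _:=_; _:+_; _:*_)

  -- Ordered-field arithmetic.  The solver works in the commutative semiring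
  -- (no subtraction), so negation is confined to the first few lemmas;
  -- `gap` then lets the remaining inequalities be proved negation-free.

  +-monoʳ-≤ : ∀ {x y} z → x ≤ y → z + x ≤ z + y
  +-monoʳ-≤ {x} {y} z x≤y = subst₂ _≤_ (+-comm x z) (+-comm y z) (+-mono-≤ z x≤y)

  +-mono₂-≤ : ∀ {a b x y} → a ≤ b → x ≤ y → a + x ≤ b + y
  +-mono₂-≤ {b = b} {x} a≤b x≤y = ≤-trans (+-mono-≤ x a≤b) (+-monoʳ-≤ b x≤y)

  +-cancelʳ-≤ : ∀ {x y} z → x + z ≤ y + z → x ≤ y
  +-cancelʳ-≤ {x} {y} z p = subst₂ _≤_ (cancel x) (cancel y) (+-mono-≤ (- z) p)
    where
    cancel : ∀ a → a + z + - z ≡ a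
    cancel a = trans (+-assoc a z (- z)) (trans (cong (a +_) (-‿inverseʳ z)) (+-identityʳ a))

  gap : ∀ {x y} → x ≤ y → Σ Carrier λ d → 0# ≤ d × y ≡ x + d
  gap {x} {y} x≤y = y + - x , subst (_≤ y + - x) (-‿inverseʳ x) (+-mono-≤ (- x) x≤y) , sym fill
    where
    fill : x + (y + - x) ≡ y
    fill = begin
      x + (y + - x)  ≡⟨ +-comm x _ ⟩
      y + - x + x    ≡⟨ +-assoc y (- x) x ⟩
      y + (- x + x)  ≡⟨ cong (y +_) (-‿inverseˡ x) ⟩
      y + 0#         ≡⟨ +-identityʳ y ⟩
      y              ∎
      where open ≡-Reasoning

  0≤x*x : ∀ x → 0# ≤ x * x
  0≤x*x x with total 0# x
  ... | inj₁ 0≤x = *-nonneg 0≤x 0≤x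
  ... | inj₂ x≤0 = subst (0# ≤_) negSquare (*-nonneg 0≤-x 0≤-x)
    where
    0≤-x : 0# ≤ - x
    0≤-x = subst₂ _≤_ (-‿inverseʳ x) (+-identityˡ (- x)) (+-mono-≤ (- x) x≤0)
    negSquare : - x * - x ≡ x * x
    negSquare = trans (sym (-‿distribˡ-* x (- x)))
                      (trans (cong -_ (sym (-‿distribʳ-* x x))) (-‿involutive (x * x)))

  0≤1 : 0# ≤ 1#
  0≤1 = subst (0# ≤_) (*-identityˡ 1#) (0≤x*x 1#)

  *-monoˡ-≤ : ∀ {w x y} → 0# ≤ w → x ≤ y → w * x ≤ w * y
  *-monoˡ-≤ {w} {x} 0≤w x≤y with gap x≤y
  ... | d , 0≤d , refl = subst₂ _≤_ (+-identityʳ (w * x)) (sym (distribˡ w x d))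
                           (+-monoʳ-≤ (w * x) (*-nonneg 0≤w 0≤d))

  *-cancelˡ-≡ : ∀ {w x y} → w ≢ 0# → w * x ≡ w * y → x ≡ y
  *-cancelˡ-≡ {w} {x} {y} w≢0 wx≡wy with inverse w w≢0
  ... | v , wv≡1 = trans (sym (undo x)) (trans (cong (v *_) wx≡wy) (undo y))
    where
    undo : ∀ z → v * (w * z) ≡ z
    undo z = trans (sym (*-assoc v w z)) (trans (cong (_* z) (trans (*-comm v w) wv≡1)) (*-identityˡ z))

  *-cancelˡ-≤ : ∀ {w x y} → 0# ≤ w → w ≢ 0# → w * x ≤ w * y → x ≤ y
  *-cancelˡ-≤ {w} {x} {y} 0≤w w≢0 wx≤wy with total x y
  ... | inj₁ x≤y = x≤y
  ... | inj₂ y≤x = ≤-reflexive (*-cancelˡ-≡ w≢0 (antisym wx≤wy (*-monoˡ-≤ 0≤w y≤x)))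

  *-nonzero : ∀ {a b} → a ≢ 0# → b ≢ 0# → a * b ≢ 0#
  *-nonzero {a} a≢0 b≢0 ab≡0 = b≢0 (*-cancelˡ-≡ a≢0 (trans ab≡0 (sym (zeroʳ a))))

  -- An ordered field has characteristic zero, so doubling can be undone.
  halve-≤ : ∀ {x y} → x + x ≤ y + y → x ≤ y
  halve-≤ {x} {y} p = *-cancelˡ-≤ 0≤2 2≢0 (subst₂ _≤_ (sym (double x)) (sym (double y)) p)
    where
    double : ∀ z → (1# + 1#) * z ≡ z + z
    double z = trans (distribʳ z 1# 1#) (cong₂ _+_ (*-identityˡ z) (*-identityˡ z))
    0≤2 : 0# ≤ 1# + 1#
    0≤2 = subst (_≤ 1# + 1#) (+-identityˡ 0#) (+-mono₂-≤ 0≤1 0≤1)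
    2≢0 : 1# + 1# ≢ 0#
    2≢0 2≡0 = 0≢1 (antisym 0≤1 (subst (1# ≤_) 2≡0 1≤2))
      where
      1≤2 : 1# ≤ 1# + 1#
      1≤2 = subst (_≤ 1# + 1#) (+-identityʳ 1#) (+-monoʳ-≤ 1# 0≤1)

  -- 2ab ≤ a² + b²: writing the larger of a, b as the smaller plus d,
  -- the difference of the two sides is d².
  am-gm-ordered : ∀ {x y} → x ≤ y → x * y + x * y ≤ x * x + y * y
  am-gm-ordered {x} x≤y with gap x≤y
  ... | d , 0≤d , refl = subst₂ _≤_ (+-identityʳ _) expand (+-monoʳ-≤ (x * (x + d) + x * (x + d)) (0≤x*x d))
    where
    expand : x * (x + d) + x * (x + d) + d * d ≡ x * x + (x + d) * (x + d)
    expand = solve 2 (λ x d → x :* (x :+ d) :+ x :* (x :+ d) :+ d :* d := x :* x :+ (x :+ d) :* (x :+ d)) refl x d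

  am-gm : ∀ a b → a * b + a * b ≤ a * a + b * b
  am-gm a b with total a b
  ... | inj₁ a≤b = am-gm-ordered a≤b
  ... | inj₂ b≤a = subst₂ _≤_ (cong₂ _+_ (*-comm b a) (*-comm b a)) (+-comm (b * b) (a * a)) (am-gm-ordered b≤a)

  open SemiringSum (CommutativeRing.semiring commutativeRing)
    using (sum; sum-cong-≗; sum-replicate-zero; ∑-distrib-+; ∑-comm; *-distribˡ-sum)

  sumFin≡sum : ∀ {n} (f : Fin n → Carrier) → sumFin f ≡ sum f
  sumFin≡sum {zero} f = refl
  sumFin≡sum {suc n} f = cong (f fzero +_) (sumFin≡sum (λ k → f (fsuc k)))

  sumFin-cong : ∀ {n} {f g : Fin n → Carrier} → (∀ k → f k ≡ g k) → sumFin f ≡ sumFin g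
  sumFin-cong {f = f} {g} f≗g = trans (sumFin≡sum f) (trans (sum-cong-≗ f≗g) (sym (sumFin≡sum g)))

  sumFin-zero : ∀ {n} {f : Fin n → Carrier} → (∀ k → f k ≡ 0#) → sumFin f ≡ 0#
  sumFin-zero {n} f≗0 = trans (sumFin-cong f≗0) (trans (sumFin≡sum {n} (λ _ → 0#)) (sum-replicate-zero n))

  sumFin-+ : ∀ {n} (f g : Fin n → Carrier) → sumFin (λ k → f k + g k) ≡ sumFin f + sumFin g
  sumFin-+ f g = trans (sumFin≡sum (λ k → f k + g k))
    (trans (∑-distrib-+ f g) (sym (cong₂ _+_ (sumFin≡sum f) (sumFin≡sum g))))

  sumFin-*ˡ : ∀ {n} (a : Carrier) (f : Fin n → Carrier) → sumFin (λ k → a * f k) ≡ a * sumFin f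
  sumFin-*ˡ a f = trans (sumFin≡sum (λ k → a * f k)) (trans (sym (*-distribˡ-sum a f)) (cong (a *_) (sym (sumFin≡sum f))))

  sumFin-*ʳ : ∀ {n} (a : Carrier) (f : Fin n → Carrier) → sumFin (λ k → f k * a) ≡ sumFin f * a
  sumFin-*ʳ a f = trans (sumFin-cong (λ k → *-comm (f k) a)) (trans (sumFin-*ˡ a f) (*-comm a (sumFin f)))

  sumFin-comm : ∀ {m n} (f : Fin m → Fin n → Carrier) →
    sumFin (λ i → sumFin (f i)) ≡ sumFin (λ j → sumFin (λ i → f i j))
  sumFin-comm f = begin
    sumFin (λ i → sumFin (f i))           ≡⟨ sumFin-cong (λ i → sumFin≡sum (f i)) ⟩
    sumFin (λ i → sum (f i))              ≡⟨ sumFin≡sum (λ i → sum (f i)) ⟩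
    sum (λ i → sum (f i))                 ≡⟨ ∑-comm f ⟩
    sum (λ j → sum (λ i → f i j))         ≡⟨ sumFin≡sum (λ j → sum (λ i → f i j)) ⟨
    sumFin (λ j → sum (λ i → f i j))      ≡⟨ sumFin-cong (λ j → sumFin≡sum (λ i → f i j)) ⟨
    sumFin (λ j → sumFin (λ i → f i j))   ∎
    where open ≡-Reasoning

  sumFin-mono : ∀ {n} {f g : Fin n → Carrier} → (∀ k → f k ≤ g k) → sumFin f ≤ sumFin g
  sumFin-mono {zero} f≤g = ≤-refl
  sumFin-mono {suc n} f≤g = +-mono₂-≤ (f≤g fzero) (sumFin-mono (λ k → f≤g (fsuc k)))

  identity-diag : ∀ {n} (x : Fin n) → identity x x ≡ 1#
  identity-diag x with x Fin.≟ x
  ... | yes _ = refl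
  ... | no x≢x = ⊥-elim (x≢x refl)

  identity-off : ∀ {n} {x y : Fin n} → x ≢ y → identity x y ≡ 0#
  identity-off {x = x} {y} x≢y with x Fin.≟ y
  ... | yes x≡y = ⊥-elim (x≢y x≡y)
  ... | no _ = refl

  identity-suc : ∀ {n} (x y : Fin n) → identity (fsuc x) (fsuc y) ≡ identity x y
  identity-suc x y with x Fin.≟ y
  ... | yes _ = refl
  ... | no _ = refl

  identity-sym : ∀ {n} (x y : Fin n) → identity x y ≡ identity y x
  identity-sym x y with x Fin.≟ y
  ... | yes refl = sym (identity-diag x)
  ... | no x≢y = sym (identity-off (λ y≡x → x≢y (sym y≡x)))

  sumFin-identity : ∀ {n} (x : Fin n) (f : Fin n → Carrier) → sumFin (λ k → identity x k * f k) ≡ f x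
  sumFin-identity {suc n} fzero f =
    trans (cong₂ _+_ (*-identityˡ (f fzero)) (sumFin-zero (λ k → zeroˡ (f (fsuc k))))) (+-identityʳ (f fzero))
  sumFin-identity {suc n} (fsuc x) f = begin
    0# * f fzero + sumFin (λ k → identity (fsuc x) (fsuc k) * f (fsuc k))
      ≡⟨ cong₂ _+_ (zeroˡ (f fzero)) (sumFin-cong (λ k → cong (_* f (fsuc k)) (identity-suc x k))) ⟩
    0# + sumFin (λ k → identity x k * f (fsuc k))
      ≡⟨ +-identityˡ _ ⟩
    sumFin (λ k → identity x k * f (fsuc k))
      ≡⟨ sumFin-identity x (λ k → f (fsuc k)) ⟩
    f (fsuc x) ∎
    where open ≡-Reasoning

  identity-row : ∀ {n} (x : Fin n) → sumFin (identity x) ≡ 1#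
  identity-row x = trans (sumFin-cong (λ k → sym (*-identityʳ (identity x k)))) (sumFin-identity x (λ _ → 1#))

  ⊗-assoc : ∀ {n} (A B D : Matrix n) x y → ((A ⊗ B) ⊗ D) x y ≡ (A ⊗ (B ⊗ D)) x y
  ⊗-assoc A B D x y = begin
    sumFin (λ m → sumFin (λ k → A x k * B k m) * D m y)   ≡⟨ sumFin-cong (λ m → sumFin-*ʳ (D m y) (λ k → A x k * B k m)) ⟨
    sumFin (λ m → sumFin (λ k → A x k * B k m * D m y))   ≡⟨ sumFin-comm (λ m k → A x k * B k m * D m y) ⟩
    sumFin (λ k → sumFin (λ m → A x k * B k m * D m y))   ≡⟨ sumFin-cong factor ⟩
    sumFin (λ k → A x k * sumFin (λ m → B k m * D m y))   ∎
    where
    open ≡-Reasoning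
    factor : ∀ k → sumFin (λ m → A x k * B k m * D m y) ≡ A x k * sumFin (λ m → B k m * D m y)
    factor k = trans (sumFin-cong (λ m → *-assoc (A x k) (B k m) (D m y))) (sumFin-*ˡ (A x k) (λ m → B k m * D m y))

  ⊗-identityˡ : ∀ {n} (A : Matrix n) x y → (identity ⊗ A) x y ≡ A x y
  ⊗-identityˡ A x y = sumFin-identity x (λ k → A k y)

  ⊗-identityʳ : ∀ {n} (A : Matrix n) x y → (A ⊗ identity) x y ≡ A x y
  ⊗-identityʳ A x y = trans (sumFin-cong (λ k → trans (*-comm (A x k) _) (cong (_* A x k) (identity-sym k y))))
                            (sumFin-identity y (A x))

  ^-+ : ∀ {n} (P : Matrix n) (a b : ℕ) x y → (P ^ (a ℕ.+ b)) x y ≡ ((P ^ a) ⊗ (P ^ b)) x y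
  ^-+ P a zero x y rewrite ℕₚ.+-identityʳ a = sym (⊗-identityʳ (P ^ a) x y)
  ^-+ P a (suc b) x y rewrite ℕₚ.+-suc a b = begin
    sumFin (λ k → (P ^ (a ℕ.+ b)) x k * P k y)             ≡⟨ sumFin-cong (λ k → cong (_* P k y) (^-+ P a b x k)) ⟩
    sumFin (λ k → ((P ^ a) ⊗ (P ^ b)) x k * P k y)         ≡⟨ ⊗-assoc (P ^ a) (P ^ b) P x y ⟩
    ((P ^ a) ⊗ ((P ^ b) ⊗ P)) x y                           ∎
    where open ≡-Reasoning

  twice : ∀ {n} → (Fin n → Carrier) → Fin n → Carrier
  twice f k = f k + f k

  _▸_ : ∀ {n} → Matrix n → (Fin n → Carrier) → Fin n → Carrier
  (A ▸ h) k = sumFin (λ l → A k l * h l)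

  column-step : ∀ {n} (P : Matrix n) s (i k : Fin n) → (P ^ suc s) k i ≡ (P ▸ (λ l → (P ^ s) l i)) k
  column-step P s i k = trans (^-+ P 1 s k i) (sumFin-cong (λ l → cong (_* (P ^ s) l i) (⊗-identityˡ P k l)))

  sumFin-probability : ∀ {n} (r : Fin n → Carrier) → sumFin r ≡ 1# → ∀ a b → sumFin (λ l → a * r l * b) ≡ a * b
  sumFin-probability r Σr≡1 a b = begin
    sumFin (λ l → a * r l * b)   ≡⟨ sumFin-cong (λ l → solve 3 (λ a r b → a :* r :* b := a :* b :* r) refl a (r l) b) ⟩
    sumFin (λ l → a * b * r l)   ≡⟨ sumFin-*ˡ (a * b) r ⟩
    a * b * sumFin r             ≡⟨ cong (a * b *_) Σr≡1 ⟩
    a * b * 1#                   ≡⟨ *-identityʳ (a * b) ⟩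
    a * b                        ∎
    where open ≡-Reasoning

  -- Jensen's inequality for squares: for a probability vector r,
  -- (Σ r_l h_l)² ≤ Σ r_l h_l².  Average 2 m h_l ≤ m² + h_l² with m = Σ r_l h_l.
  jensen : ∀ {n} (r h : Fin n → Carrier) → (∀ l → 0# ≤ r l) → sumFin r ≡ 1# →
    sumFin (λ l → r l * h l) * sumFin (λ l → r l * h l) ≤ sumFin (λ l → r l * (h l * h l))
  jensen {n} r h 0≤r Σr≡1 =
    +-cancelʳ-≤ (m * m) (subst₂ _≤_ averaged-lhs averaged-rhs (sumFin-mono (λ l → *-monoˡ-≤ (0≤r l) (am-gm m (h l)))))
    where
    open ≡-Reasoning
    m : Carrier
    m = sumFin (λ l → r l * h l)
    mh : Fin n → Carrier
    mh l = m * (r l * h l)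
    averaged-lhs : sumFin (λ l → r l * (m * h l + m * h l)) ≡ m * m + m * m
    averaged-lhs = begin
      sumFin (λ l → r l * (m * h l + m * h l))
        ≡⟨ sumFin-cong (λ l → solve 3 (λ r m h → r :* (m :* h :+ m :* h) := m :* (r :* h) :+ m :* (r :* h)) refl (r l) m (h l)) ⟩
      sumFin (λ l → mh l + mh l)          ≡⟨ sumFin-+ mh mh ⟩
      sumFin mh + sumFin mh               ≡⟨ cong₂ _+_ (sumFin-*ˡ m (λ l → r l * h l)) (sumFin-*ˡ m (λ l → r l * h l)) ⟩
      m * m + m * m                       ∎
    averaged-rhs : sumFin (λ l → r l * (m * m + h l * h l)) ≡ sumFin (λ l → r l * (h l * h l)) + m * m
    averaged-rhs = begin
      sumFin (λ l → r l * (m * m + h l * h l))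
        ≡⟨ sumFin-cong (λ l → trans (distribˡ (r l) _ _) (+-comm _ _)) ⟩
      sumFin (λ l → r l * (h l * h l) + r l * (m * m))
        ≡⟨ sumFin-+ (λ l → r l * (h l * h l)) (λ l → r l * (m * m)) ⟩
      sumFin (λ l → r l * (h l * h l)) + sumFin (λ l → r l * (m * m))
        ≡⟨ cong (sumFin (λ l → r l * (h l * h l)) +_)
             (trans (sumFin-*ʳ (m * m) r) (trans (cong (_* (m * m)) Σr≡1) (*-identityˡ (m * m)))) ⟩
      sumFin (λ l → r l * (h l * h l)) + m * m ∎

  module Weighted {n} (w : Fin n → Carrier) where

    Reversible : Matrix n → Set c
    Reversible A = ∀ x y → w x * A x y ≡ w y * A y x

    ⟪_,_⟫ : (Fin n → Carrier) → (Fin n → Carrier) → Carrier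
    ⟪ f , g ⟫ = sumFin (λ k → w k * (f k * g k))

    ⟪⟫-cong : ∀ {f f′ g g′ : Fin n → Carrier} → (∀ k → f k ≡ f′ k) → (∀ k → g k ≡ g′ k) →
      ⟪ f , g ⟫ ≡ ⟪ f′ , g′ ⟫
    ⟪⟫-cong f≗f′ g≗g′ = sumFin-cong (λ k → cong (w k *_) (cong₂ _*_ (f≗f′ k) (g≗g′ k)))

    ⟪⟫-comm : ∀ (f g : Fin n → Carrier) → ⟪ f , g ⟫ ≡ ⟪ g , f ⟫
    ⟪⟫-comm f g = sumFin-cong (λ k → cong (w k *_) (*-comm (f k) (g k)))

    ⟪⟫-twiceʳ : ∀ (f g : Fin n → Carrier) → ⟪ f , twice g ⟫ ≡ ⟪ f , g ⟫ + ⟪ f , g ⟫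
    ⟪⟫-twiceʳ f g = trans (sumFin-cong (λ k → trans (cong (w k *_) (distribˡ (f k) (g k) (g k))) (distribˡ (w k) _ _)))
                          (sumFin-+ (λ k → w k * (f k * g k)) (λ k → w k * (f k * g k)))

    ⟪⟫-twice : ∀ (g : Fin n → Carrier) → ⟪ twice g , twice g ⟫ ≡ (⟪ g , g ⟫ + ⟪ g , g ⟫) + (⟪ g , g ⟫ + ⟪ g , g ⟫)
    ⟪⟫-twice g = trans (⟪⟫-twiceʳ (twice g) g) (cong₂ _+_ inner inner)
      where
      inner : ⟪ twice g , g ⟫ ≡ ⟪ g , g ⟫ + ⟪ g , g ⟫
      inner = trans (⟪⟫-comm (twice g) g) (⟪⟫-twiceʳ g g)

    identity-reversible : Reversible identity
    identity-reversible x y with x Fin.≟ y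
    ... | yes refl = cong (w x *_) (sym (identity-diag x))
    ... | no x≢y = begin
      w x * 0#               ≡⟨ zeroʳ (w x) ⟩
      0#                     ≡⟨ zeroʳ (w y) ⟨
      w y * 0#               ≡⟨ cong (w y *_) (identity-off (λ y≡x → x≢y (sym y≡x))) ⟨
      w y * identity y x     ∎
      where open ≡-Reasoning

    ⊗-reversible : ∀ {A B} → Reversible A → Reversible B → ∀ x y → w x * (A ⊗ B) x y ≡ w y * (B ⊗ A) y x
    ⊗-reversible {A} {B} revA revB x y =
      trans (sym (sumFin-*ˡ (w x) (λ m → A x m * B m y)))
            (trans (sumFin-cong termwise) (sumFin-*ˡ (w y) (λ m → B y m * A m x)))
      where
      open ≡-Reasoning
      termwise : ∀ m → w x * (A x m * B m y) ≡ w y * (B y m * A m x)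
      termwise m = begin
        w x * (A x m * B m y)   ≡⟨ *-assoc (w x) _ _ ⟨
        w x * A x m * B m y     ≡⟨ cong (_* B m y) (revA x m) ⟩
        w m * A m x * B m y     ≡⟨ solve 3 (λ a b c → a :* b :* c := b :* (a :* c)) refl (w m) (A m x) (B m y) ⟩
        A m x * (w m * B m y)   ≡⟨ cong (A m x *_) (revB m y) ⟩
        A m x * (w y * B y m)   ≡⟨ solve 3 (λ a b c → a :* (b :* c) := b :* (c :* a)) refl (A m x) (w y) (B y m) ⟩
        w y * (B y m * A m x)   ∎

    -- Powers of a reversible matrix are reversible (P commutes with P^t).
    ^-reversible : ∀ {P} → Reversible P → ∀ t → Reversible (P ^ t)
    ^-reversible revP zero = identity-reversible
    ^-reversible {P} revP (suc t) x y = begin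
      w x * ((P ^ t) ⊗ P) x y        ≡⟨ ⊗-reversible (^-reversible revP t) revP x y ⟩
      w y * (P ⊗ (P ^ t)) y x        ≡⟨ cong (w y *_) (sumFin-cong (λ k → cong (_* (P ^ t) k x) (⊗-identityˡ P y k))) ⟨
      w y * ((P ^ 1) ⊗ (P ^ t)) y x  ≡⟨ cong (w y *_) (^-+ P 1 t y x) ⟨
      w y * (P ^ suc t) y x          ∎
      where open ≡-Reasoning

    return-inner : ∀ {P} → Reversible P → ∀ i a b →
      w i * (P ^ (a ℕ.+ b)) i i ≡ ⟪ (λ k → (P ^ a) k i) , (λ k → (P ^ b) k i) ⟫
    return-inner {P} revP i a b = begin
      w i * (P ^ (a ℕ.+ b)) i i                               ≡⟨ cong (w i *_) (^-+ P a b i i) ⟩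
      w i * sumFin (λ k → (P ^ a) i k * (P ^ b) k i)          ≡⟨ sumFin-*ˡ (w i) (λ k → (P ^ a) i k * (P ^ b) k i) ⟨
      sumFin (λ k → w i * ((P ^ a) i k * (P ^ b) k i))        ≡⟨ sumFin-cong transpose ⟩
      ⟪ (λ k → (P ^ a) k i) , (λ k → (P ^ b) k i) ⟫            ∎
      where
      open ≡-Reasoning
      transpose : ∀ k → w i * ((P ^ a) i k * (P ^ b) k i) ≡ w k * ((P ^ a) k i * (P ^ b) k i)
      transpose k = trans (sym (*-assoc (w i) _ _))
                          (trans (cong (_* (P ^ b) k i) (^-reversible revP a i k)) (*-assoc (w k) _ _))

    flowSum : Matrix n → (Fin n → Fin n → Carrier) → Carrier
    flowSum S φ = sumFin (λ k → sumFin (λ l → w k * S k l * φ k l))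

    flowSum-+ : ∀ S (φ ψ : Fin n → Fin n → Carrier) →
      flowSum S (λ k l → φ k l + ψ k l) ≡ flowSum S φ + flowSum S ψ
    flowSum-+ S φ ψ = trans (sumFin-cong (λ k → trans (sumFin-cong (λ l → distribˡ (w k * S k l) (φ k l) (ψ k l)))
                                                       (sumFin-+ (λ l → w k * S k l * φ k l) (λ l → w k * S k l * ψ k l))))
                            (sumFin-+ (λ k → sumFin (λ l → w k * S k l * φ k l)) (λ k → sumFin (λ l → w k * S k l * ψ k l)))

    flowSum-mono : ∀ {S} {φ ψ : Fin n → Fin n → Carrier} → (∀ k → 0# ≤ w k) → (∀ k l → 0# ≤ S k l) →
      (∀ k l → φ k l ≤ ψ k l) → flowSum S φ ≤ flowSum S ψ
    flowSum-mono 0≤w 0≤S φ≤ψ = sumFin-mono (λ k → sumFin-mono (λ l → *-monoˡ-≤ (*-nonneg (0≤w k) (0≤S k l)) (φ≤ψ k l)))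

    flowSum-source : ∀ {S} → (∀ k → sumFin (S k) ≡ 1#) → ∀ (g : Fin n → Carrier) →
      flowSum S (λ k l → g k) ≡ sumFin (λ k → w k * g k)
    flowSum-source {S} rows g = sumFin-cong (λ k → sumFin-probability (S k) (rows k) (w k) (g k))

    flowSum-target : ∀ {S} → Reversible S → (∀ k → sumFin (S k) ≡ 1#) → ∀ (g : Fin n → Carrier) →
      flowSum S (λ k l → g l) ≡ sumFin (λ l → w l * g l)
    flowSum-target {S} revS rows g = begin
      flowSum S (λ k l → g l)                            ≡⟨ sumFin-cong (λ k → sumFin-cong (λ l → cong (_* g l) (revS k l))) ⟩
      sumFin (λ k → sumFin (λ l → w l * S l k * g l))    ≡⟨ sumFin-comm (λ k l → w l * S l k * g l) ⟩
      flowSum S (λ l k → g l)                            ≡⟨ flowSum-source rows g ⟩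
      sumFin (λ l → w l * g l)                           ∎
      where open ≡-Reasoning

    stationary : ∀ {S} → Reversible S → (∀ k → sumFin (S k) ≡ 1#) → ∀ (g : Fin n → Carrier) →
      sumFin (λ k → w k * (S ▸ g) k) ≡ sumFin (λ l → w l * g l)
    stationary {S} revS rows g = trans (sumFin-cong distribute) (flowSum-target revS rows g)
      where
      distribute : ∀ k → w k * (S ▸ g) k ≡ sumFin (λ l → w k * S k l * g l)
      distribute k = trans (sym (sumFin-*ˡ (w k) (λ l → S k l * g l))) (sumFin-cong (λ l → sym (*-assoc (w k) (S k l) (g l))))

    inner-▸ : ∀ S (f g : Fin n → Carrier) → ⟪ f , S ▸ g ⟫ ≡ flowSum S (λ k l → f k * g l)
    inner-▸ S f g = sumFin-cong distribute
      where
      distribute : ∀ k → w k * (f k * (S ▸ g) k) ≡ sumFin (λ l → w k * S k l * (f k * g l))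
      distribute k = begin
        w k * (f k * (S ▸ g) k)                          ≡⟨ cong (w k *_) (sumFin-*ˡ (f k) (λ l → S k l * g l)) ⟨
        w k * sumFin (λ l → f k * (S k l * g l))         ≡⟨ sumFin-*ˡ (w k) (λ l → f k * (S k l * g l)) ⟨
        sumFin (λ l → w k * (f k * (S k l * g l)))
          ≡⟨ sumFin-cong (λ l → solve 4 (λ w f s g → w :* (f :* (s :* g)) := w :* s :* (f :* g)) refl (w k) (f k) (S k l) (g l)) ⟩
        sumFin (λ l → w k * S k l * (f k * g l))         ∎
        where open ≡-Reasoning

    -- Dirichlet-form bound ⟨h, S h⟩ ≤ ⟨h, h⟩ for reversible stochastic S:
    -- 2⟨h, S h⟩ = Σ w_k S_kl 2 h_k h_l ≤ Σ w_k S_kl (h_k² + h_l²) = 2⟨h, h⟩.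
    dirichlet : (∀ k → 0# ≤ w k) → ∀ {S} → IsStochastic S → Reversible S →
      ∀ (h : Fin n → Carrier) → ⟪ h , S ▸ h ⟫ ≤ ⟪ h , h ⟫
    dirichlet 0≤w {S} (0≤S , rows) revS h =
      halve-≤ (subst₂ _≤_ products squares (flowSum-mono 0≤w 0≤S (λ k l → am-gm (h k) (h l))))
      where
      products : flowSum S (λ k l → h k * h l + h k * h l) ≡ ⟪ h , S ▸ h ⟫ + ⟪ h , S ▸ h ⟫
      products = trans (flowSum-+ S (λ k l → h k * h l) (λ k l → h k * h l)) (sym (cong₂ _+_ (inner-▸ S h h) (inner-▸ S h h)))
      squares : flowSum S (λ k l → h k * h k + h l * h l) ≡ ⟪ h , h ⟫ + ⟪ h , h ⟫
      squares = trans (flowSum-+ S (λ k l → h k * h k) (λ k l → h l * h l))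
                      (cong₂ _+_ (flowSum-source rows (λ k → h k * h k)) (flowSum-target revS rows (λ l → h l * h l)))

    -- A reversible stochastic matrix is a contraction for ⟨·,·⟩_w:
    -- row-wise Jensen, then stationarity of w.
    contraction : (∀ k → 0# ≤ w k) → ∀ {S} → IsStochastic S → Reversible S →
      ∀ (h : Fin n → Carrier) → ⟪ S ▸ h , S ▸ h ⟫ ≤ ⟪ h , h ⟫
    contraction 0≤w {S} (0≤S , rows) revS h =
      subst (⟪ S ▸ h , S ▸ h ⟫ ≤_) (stationary revS rows (λ l → h l * h l))
        (sumFin-mono (λ k → *-monoˡ-≤ (0≤w k) (jensen (S k) h (0≤S k) (rows k))))

    -- A lazy chain (P_kk ≥ 1/2) is P = (I + R)/2 for another reversible
    -- stochastic matrix R = 2P - I.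
    module Lazy {P : Matrix n} (stochastic : IsStochastic P) (revP : Reversible P)
                (lazy : ∀ k → 1# ≤ P k k + P k k) where

      0≤P : ∀ x y → 0# ≤ P x y
      0≤P = proj₁ stochastic

      rowsP : ∀ x → sumFin (P x) ≡ 1#
      rowsP = proj₂ stochastic

      -- R + I = 2P is the only property of R used below.
      R : Matrix n
      R x y = P x y + P x y + - identity x y

      R-split : ∀ x y → R x y + identity x y ≡ P x y + P x y
      R-split x y = trans (+-assoc (P x y + P x y) _ _) (trans (cong (P x y + P x y +_) (-‿inverseˡ _)) (+-identityʳ _))

      R-stochastic : IsStochastic R
      R-stochastic = nonneg , rows
        where
        nonneg : ∀ x y → 0# ≤ R x y
        nonneg x y = diagonal-or-not (x Fin.≟ y)
          where
          diagonal-or-not : Dec (x ≡ y) → 0# ≤ R x y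
          diagonal-or-not (yes refl) = +-cancelʳ-≤ 1# (subst₂ _≤_ (sym (+-identityˡ 1#)) twoP (lazy x))
            where
            twoP : P x x + P x x ≡ R x x + 1#
            twoP = trans (sym (R-split x x)) (cong (R x x +_) (identity-diag x))
          diagonal-or-not (no x≢y) = subst (0# ≤_) twoP (subst (_≤ P x y + P x y) (+-identityʳ 0#) (+-mono₂-≤ (0≤P x y) (0≤P x y)))
            where
            twoP : P x y + P x y ≡ R x y
            twoP = trans (sym (R-split x y)) (trans (cong (R x y +_) (identity-off x≢y)) (+-identityʳ (R x y)))
        rows : ∀ x → sumFin (R x) ≡ 1#
        rows x = +-cancelʳ 1# (sumFin (R x)) 1# (begin
          sumFin (R x) + 1#                                ≡⟨ cong (sumFin (R x) +_) (identity-row x) ⟨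
          sumFin (R x) + sumFin (identity x)               ≡⟨ sumFin-+ (R x) (identity x) ⟨
          sumFin (λ y → R x y + identity x y)              ≡⟨ sumFin-cong (R-split x) ⟩
          sumFin (λ y → P x y + P x y)                     ≡⟨ sumFin-+ (P x) (P x) ⟩
          sumFin (P x) + sumFin (P x)                      ≡⟨ cong₂ _+_ (rowsP x) (rowsP x) ⟩
          1# + 1#                                          ∎)
          where open ≡-Reasoning

      R-reversible : Reversible R
      R-reversible x y = +-cancelʳ (w x * identity x y) (w x * R x y) (w y * R y x) (begin
        w x * R x y + w x * identity x y     ≡⟨ scaled-split x y ⟩
        w x * P x y + w x * P x y            ≡⟨ cong₂ _+_ (revP x y) (revP x y) ⟩
        w y * P y x + w y * P y x            ≡⟨ scaled-split y x ⟨
        w y * R y x + w y * identity y x     ≡⟨ cong (w y * R y x +_) (identity-reversible x y) ⟨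
        w y * R y x + w x * identity x y     ∎)
        where
        open ≡-Reasoning
        scaled-split : ∀ x y → w x * R x y + w x * identity x y ≡ w x * P x y + w x * P x y
        scaled-split x y = trans (sym (distribˡ (w x) _ _)) (trans (cong (w x *_) (R-split x y)) (distribˡ (w x) _ _))

      R-▸ : ∀ (h : Fin n → Carrier) k → (R ▸ h) k + h k ≡ twice (P ▸ h) k
      R-▸ h k = begin
        (R ▸ h) k + h k                                          ≡⟨ cong ((R ▸ h) k +_) (sumFin-identity k h) ⟨
        (R ▸ h) k + (identity ▸ h) k                             ≡⟨ sumFin-+ (λ l → R k l * h l) (λ l → identity k l * h l) ⟨
        sumFin (λ l → R k l * h l + identity k l * h l)          ≡⟨ sumFin-cong split ⟩
        sumFin (λ l → P k l * h l + P k l * h l)                 ≡⟨ sumFin-+ (λ l → P k l * h l) (λ l → P k l * h l) ⟩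
        (P ▸ h) k + (P ▸ h) k                                    ∎
        where
        open ≡-Reasoning
        split : ∀ l → R k l * h l + identity k l * h l ≡ P k l * h l + P k l * h l
        split l = trans (sym (distribʳ (h l) _ _)) (trans (cong (_* h l) (R-split k l)) (distribʳ (h l) _ _))

      -- With g = 2 P h = R h + h:  ⟨R h, R h⟩ + 2⟨h, g⟩ = ⟨g, g⟩ + ⟨h, h⟩,
      -- since (g - h)² + 2hg = g² + h².
      R-energy : ∀ (h : Fin n → Carrier) → let g = twice (P ▸ h) in
        ⟪ R ▸ h , R ▸ h ⟫ + (⟪ h , g ⟫ + ⟪ h , g ⟫) ≡ ⟪ g , g ⟫ + ⟪ h , h ⟫
      R-energy h = begin
        ⟪ b , b ⟫ + (⟪ h , g ⟫ + ⟪ h , g ⟫)                   ≡⟨ cong (⟪ b , b ⟫ +_) (sumFin-+ hg hg) ⟨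
        ⟪ b , b ⟫ + sumFin (λ k → hg k + hg k)                ≡⟨ sumFin-+ (λ k → w k * (b k * b k)) (λ k → hg k + hg k) ⟨
        sumFin (λ k → w k * (b k * b k) + (hg k + hg k))      ≡⟨ sumFin-cong pointwise ⟩
        sumFin (λ k → w k * (g k * g k) + w k * (h k * h k))  ≡⟨ sumFin-+ (λ k → w k * (g k * g k)) (λ k → w k * (h k * h k)) ⟩
        ⟪ g , g ⟫ + ⟪ h , h ⟫                                 ∎
        where
        open ≡-Reasoning
        b g hg : Fin n → Carrier
        b = R ▸ h
        g = twice (P ▸ h)
        hg k = w k * (h k * g k)
        pointwise : ∀ k → w k * (b k * b k) + (hg k + hg k) ≡ w k * (g k * g k) + w k * (h k * h k)
        pointwise k = subst (λ z → w k * (b k * b k) + (w k * (h k * z) + w k * (h k * z)) ≡ w k * (z * z) + w k * (h k * h k))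
          (R-▸ h k)
          (solve 3 (λ w b h → w :* (b :* b) :+ (w :* (h :* (b :+ h)) :+ w :* (h :* (b :+ h)))
                              := w :* ((b :+ h) :* (b :+ h)) :+ w :* (h :* h)) refl (w k) (b k) (h k))

      -- ⟨P h, P h⟩ ≤ ⟨h, P h⟩: by R-energy and ⟨R h, R h⟩ ≤ ⟨h, h⟩,
      -- ⟨2 P h, 2 P h⟩ ≤ 2⟨h, 2 P h⟩; then divide by four.
      lazy-contraction : (∀ k → 0# ≤ w k) → ∀ (h : Fin n → Carrier) → ⟪ P ▸ h , P ▸ h ⟫ ≤ ⟪ h , P ▸ h ⟫
      lazy-contraction 0≤w h =
        halve-≤ (halve-≤ (subst₂ _≤_ (⟪⟫-twice (P ▸ h)) (cong₂ _+_ (⟪⟫-twiceʳ h (P ▸ h)) (⟪⟫-twiceʳ h (P ▸ h))) bound))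
        where
        bound : ⟪ twice (P ▸ h) , twice (P ▸ h) ⟫ ≤ ⟪ h , twice (P ▸ h) ⟫ + ⟪ h , twice (P ▸ h) ⟫
        bound = +-cancelʳ-≤ ⟪ h , h ⟫ (subst₂ _≤_ (R-energy h) (+-comm _ _)
          (+-mono-≤ (⟪ h , twice (P ▸ h) ⟫ + ⟪ h , twice (P ▸ h) ⟫) (contraction 0≤w R-stochastic R-reversible h)))

    -- Return probabilities of a reversible lazy chain never increase:
    -- w_i P^(2s+1)_ii = ⟨h, P h⟩ ≤ ⟨h, h⟩ = w_i P^(2s)_ii and
    -- w_i P^(2s+2)_ii = ⟨P h, P h⟩ ≤ ⟨h, P h⟩, where h is column i of P^s.
    lazy-return-decreasing : (∀ k → 0# ≤ w k) → (∀ k → w k ≢ 0#) → ∀ {P} → IsStochastic P → Reversible P →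
      (∀ k → 1# ≤ P k k + P k k) → ∀ i t → (P ^ suc t) i i ≤ (P ^ t) i i
    lazy-return-decreasing 0≤w w≢0 {P} stochastic revP lazy i t = *-cancelˡ-≤ (0≤w i) (w≢0 i) (weighted (evenOdd t))
      where
      open Lazy stochastic revP lazy using (lazy-contraction)

      column : ℕ → Fin n → Carrier
      column s k = (P ^ s) k i

      return-even : ∀ s → w i * (P ^ (s ℕ.+ s)) i i ≡ ⟪ column s , column s ⟫
      return-even s = return-inner revP i s s

      return-odd : ∀ s → w i * (P ^ suc (s ℕ.+ s)) i i ≡ ⟪ column s , P ▸ column s ⟫
      return-odd s = trans (cong (λ u → w i * (P ^ u) i i) (sym (ℕₚ.+-suc s s)))
                           (trans (return-inner revP i s (suc s)) (⟪⟫-cong (λ _ → refl) (column-step P s i)))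

      return-next-even : ∀ s → w i * (P ^ suc (suc (s ℕ.+ s))) i i ≡ ⟪ P ▸ column s , P ▸ column s ⟫
      return-next-even s = trans (cong (λ u → w i * (P ^ suc u) i i) (sym (ℕₚ.+-suc s s)))
                                 (trans (return-inner revP i (suc s) (suc s)) (⟪⟫-cong (column-step P s i) (column-step P s i)))

      weighted : ∀ {t} → EvenOdd t → w i * (P ^ suc t) i i ≤ w i * (P ^ t) i i
      weighted (even s) = subst₂ _≤_ (sym (return-odd s)) (sym (return-even s)) (dirichlet 0≤w stochastic revP (column s))
      weighted (odd s) = subst₂ _≤_ (sym (return-next-even s)) (sym (return-odd s)) (lazy-contraction 0≤w (column s))

  closed-set : ∀ {n} (P : Matrix n) (Q : Fin n → Set) → Decidable Q →
    (∀ m y → Q m → ¬ Q y → P m y ≡ 0#) → ∀ t x y → Q x → ¬ Q y → (P ^ t) x y ≡ 0#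
  closed-set P Q Q? leak zero x y Qx ¬Qy = identity-off (λ x≡y → ¬Qy (subst Q x≡y Qx))
  closed-set P Q Q? leak (suc t) x y Qx ¬Qy = sumFin-zero step
    where
    step : ∀ m → (P ^ t) x m * P m y ≡ 0#
    step m with Q? m
    ... | yes Qm = trans (cong ((P ^ t) x m *_) (leak m y Qm ¬Qy)) (zeroʳ _)
    ... | no ¬Qm = trans (cong (_* P m y) (closed-set P Q Q? leak t x m Qx ¬Qm)) (zeroˡ _)

  irreducible-leaks : ∀ {n} {P : Matrix n} → Irreducible P → (Q : Fin n → Set) → Decidable Q →
    (∀ m y → Q m → ¬ Q y → P m y ≡ 0#) → ∀ x y → Q x → ¬ Q y → ⊥
  irreducible-leaks {P = P} irreducible Q Q? leak x y Qx ¬Qy with irreducible x y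
  ... | t , _ , 0≢Pᵗxy = 0≢Pᵗxy (sym (closed-set P Q Q? leak t x y Qx ¬Qy))

  -- Weights for a birth–death chain with forward rates A and backward
  -- rates B: vertex x of the path gets ∏_{j<x} A_j · ∏_{j≥x} B_j.
  pathWeight : ∀ {d} → (Fin d → Carrier) → (Fin d → Carrier) → Fin (suc d) → Carrier
  pathWeight {zero} A B fzero = 1#
  pathWeight {suc d} A B fzero = B fzero * pathWeight (λ j → A (fsuc j)) (λ j → B (fsuc j)) fzero
  pathWeight {suc d} A B (fsuc x) = A fzero * pathWeight (λ j → A (fsuc j)) (λ j → B (fsuc j)) x

  pathWeight-balance : ∀ {d} (A B : Fin d → Carrier) (j : Fin d) →
    pathWeight A B (inject₁ j) * A j ≡ pathWeight A B (fsuc j) * B j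
  pathWeight-balance {suc d} A B fzero =
    solve 3 (λ b w a → b :* w :* a := a :* w :* b) refl (B fzero) (pathWeight (λ j → A (fsuc j)) (λ j → B (fsuc j)) fzero) (A fzero)
  pathWeight-balance {suc d} A B (fsuc j) = begin
    A fzero * W (inject₁ j) * A (fsuc j)     ≡⟨ *-assoc (A fzero) _ _ ⟩
    A fzero * (W (inject₁ j) * A (fsuc j))   ≡⟨ cong (A fzero *_) (pathWeight-balance (λ j → A (fsuc j)) (λ j → B (fsuc j)) j) ⟩
    A fzero * (W (fsuc j) * B (fsuc j))      ≡⟨ *-assoc (A fzero) _ _ ⟨
    A fzero * W (fsuc j) * B (fsuc j)        ∎
    where
    open ≡-Reasoning
    W : Fin (suc d) → Carrier
    W = pathWeight (λ j → A (fsuc j)) (λ j → B (fsuc j))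

  pathWeight-nonneg : ∀ {d} {A B : Fin d → Carrier} → (∀ j → 0# ≤ A j) → (∀ j → 0# ≤ B j) →
    ∀ x → 0# ≤ pathWeight A B x
  pathWeight-nonneg {zero} 0≤A 0≤B fzero = 0≤1
  pathWeight-nonneg {suc d} 0≤A 0≤B fzero = *-nonneg (0≤B fzero) (pathWeight-nonneg (λ j → 0≤A (fsuc j)) (λ j → 0≤B (fsuc j)) fzero)
  pathWeight-nonneg {suc d} 0≤A 0≤B (fsuc x) = *-nonneg (0≤A fzero) (pathWeight-nonneg (λ j → 0≤A (fsuc j)) (λ j → 0≤B (fsuc j)) x)

  pathWeight-nonzero : ∀ {d} {A B : Fin d → Carrier} → (∀ j → A j ≢ 0#) → (∀ j → B j ≢ 0#) →
    ∀ x → pathWeight A B x ≢ 0#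
  pathWeight-nonzero {zero} A≢0 B≢0 fzero 1≡0 = 0≢1 (sym 1≡0)
  pathWeight-nonzero {suc d} A≢0 B≢0 fzero = *-nonzero (B≢0 fzero) (pathWeight-nonzero (λ j → A≢0 (fsuc j)) (λ j → B≢0 (fsuc j)) fzero)
  pathWeight-nonzero {suc d} A≢0 B≢0 (fsuc x) = *-nonzero (A≢0 fzero) (pathWeight-nonzero (λ j → A≢0 (fsuc j)) (λ j → B≢0 (fsuc j)) x)

  module PathChain {d} {P : Matrix (suc d)} (stochastic : IsStochastic P) (irreducible : Irreducible P)
                   (path : IsPathChain P) where

    forward backward : Fin d → Carrier
    forward j = P (inject₁ j) (fsuc j)
    backward j = P (fsuc j) (inject₁ j)

    -- {0,…,j} can only be left by the step j → j+1, so it has positive probability.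
    forward-nonzero : ∀ j → forward j ≢ 0#
    forward-nonzero j forward≡0 =
      irreducible-leaks irreducible Q Q? leak (inject₁ j) (fsuc j) (ℕₚ.≤-reflexive (toℕ-inject₁ j)) (ℕₚ.<-irrefl refl)
      where
      Q : Fin (suc d) → Set
      Q m = toℕ m ℕ.≤ toℕ j
      Q? : Decidable Q
      Q? m = toℕ m ℕ.≤? toℕ j
      leak : ∀ m y → Q m → ¬ Q y → P m y ≡ 0#
      leak m y m≤j y≰j with crossing j m y m≤j (ℕₚ.≰⇒> y≰j)
      ... | inj₁ distant = path m y distant
      ... | inj₂ (refl , refl) = forward≡0

    -- {j+1,…,d} can only be left by the step j+1 → j.
    backward-nonzero : ∀ j → backward j ≢ 0#
    backward-nonzero j backward≡0 =
      irreducible-leaks irreducible Q Q? leak (fsuc j) (inject₁ j) ℕₚ.≤-refl (ℕₚ.<-irrefl (sym (toℕ-inject₁ j)))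
      where
      Q : Fin (suc d) → Set
      Q m = toℕ j ℕ.< toℕ m
      Q? : Decidable Q
      Q? m = toℕ j ℕ.<? toℕ m
      leak : ∀ m y → Q m → ¬ Q y → P m y ≡ 0#
      leak m y j<m j≮y with crossing j y m (ℕₚ.≮⇒≥ j≮y) j<m
      ... | inj₁ distant = path m y (subst (1 ℕ.<_) (ℕₚ.∣-∣-comm (toℕ y) (toℕ m)) distant)
      ... | inj₂ (refl , refl) = backward≡0

    weight : Fin (suc d) → Carrier
    weight = pathWeight forward backward

    weight-nonneg : ∀ x → 0# ≤ weight x
    weight-nonneg = pathWeight-nonneg (λ j → proj₁ stochastic _ _) (λ j → proj₁ stochastic _ _)

    weight-nonzero : ∀ x → weight x ≢ 0#
    weight-nonzero = pathWeight-nonzero forward-nonzero backward-nonzero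

    open Weighted weight using (Reversible)

    reversible : Reversible P
    reversible x y with position x y
    ... | same _ = refl
    ... | up j = pathWeight-balance forward backward j
    ... | down j = sym (pathWeight-balance forward backward j)
    ... | far x↮y = begin
      weight x * P x y     ≡⟨ cong (weight x *_) (path x y x↮y) ⟩
      weight x * 0#        ≡⟨ zeroʳ (weight x) ⟩
      0#                   ≡⟨ zeroʳ (weight y) ⟨
      weight y * 0#        ≡⟨ cong (weight y *_) (path y x (subst (1 ℕ.<_) (ℕₚ.∣-∣-comm (toℕ x) (toℕ y)) x↮y)) ⟨
      weight y * P y x     ∎
      where open ≡-Reasoning

mainTheorem12 : ∀ {c ℓ} (F : OrderedField c ℓ) → let open OrderedField F in let open Matrices F in
    (d : ℕ) (P : Matrix (suc d)) →
    IsErgodic P → IsPathChain P →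
    (∀ i → 1# ≤ P i i + P i i) →
    ∀ (i : Fin (suc d)) (t : ℕ) → (P ^ suc t) i i ≤ (P ^ t) i i
mainTheorem12 F d P (stochastic , irreducible , _) path lazy =
  Weighted.lazy-return-decreasing weight weight-nonneg weight-nonzero stochastic reversible lazy
  where
  open LazyChains F
  open PathChain stochastic irreducible path
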